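{- Let $G=([n],E)$ be a directed acyclic graph with weights $w\in\mathbb{R}^E$. If the regular subdivision of the fundamental polytope $\Delta_G$ induced by the height function $(0,w)\in\mathbb{R}\times\mathbb{R}^E$ is a central triangulation, then $G^\flat_w=G$.
   Context: The fundamental polytope $\Delta_G$ is the point configuration $\{0\}\cup\{e_i-e_j : j\to i\in E\}\subseteq\mathbb{R}^n$; the height function $(0,w)$ assigns height $0$ to the origin and $w(j\to i)$ to $e_i-e_j$, and the induced regular subdivision is the projection of the lower faces of the convex hull of the lifted points. A subdivision is central if the origin is a vertex of every maximal cell, and a triangulation if all cells are simplices. The weighted transitive reduction $G^\flat_w$ is the subgraph of $G$ consisting of the edges $j\to i$ such that the one-edge path $j\to i$ is the unique shortest (minimum total weight) directed path from $j$ to $i$ in $G$. -}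

module Defs where

open import Level using (Level; suc; _⊔_)
open import Data.Nat using (ℕ) renaming (zero to nzero; suc to nsuc)
open import Data.Fin using (Fin)
open import Data.Fin.Properties using () renaming (_≟_ to _≟ᶠ_)
open import Data.Bool using (Bool; true; false)
open import Data.Maybe using (Maybe; just; nothing)
open import Data.Product using (Σ; _×_; _,_)
open import Data.List using (List; foldr; map; allFin)
open import Relation.Nullary using (¬_; yes; no)
open import Relation.Binary.PropositionalEquality using (_≡_; _≢_)
open import Algebra.Structures using (IsCommutativeRing)
open import Relation.Binary.Structures using (IsTotalOrder)
open import Function.Bundles using (_⇔_)

record OrderedField (c : Level) : Set (suc c) where
  infixl 6 _+_ _-_
  infixl 7 _*_
  infix 4 _≤_ _<_
  field
    Carrier : Set c
    _+_ _*_ : Carrier → Carrier → Carrier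
    -_      : Carrier → Carrier
    0# 1#   : Carrier
    _≤_     : Carrier → Carrier → Set c
    isCommutativeRing : IsCommutativeRing _≡_ _+_ _*_ -_ 0# 1#
    ≤-isTotalOrder    : IsTotalOrder _≡_ _≤_
    0≢1     : 0# ≢ 1#
    +-monoˡ-≤ : ∀ {x y} z → x ≤ y → x + z ≤ y + z
    *-nonneg  : ∀ {x y} → 0# ≤ x → 0# ≤ y → 0# ≤ x * y
    inverse   : ∀ x → x ≢ 0# → Σ Carrier (λ y → x * y ≡ 1#)

  _-_ : Carrier → Carrier → Carrier
  x - y = x + (- y)

  _<_ : Carrier → Carrier → Set c
  x < y = (x ≤ y) × (x ≢ y)

module Geometry {c : Level} (F : OrderedField c) (n : ℕ)
                (E : Fin n → Fin n → Bool) where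
  open OrderedField F

  -- E j i ≡ true  means the edge  j → i  belongs to G.
  Edge : Fin n → Fin n → Set
  Edge j i = E j i ≡ true

  -- Weights: w j i is the weight of the edge j → i (irrelevant off E).
  Weights : Set c
  Weights = Fin n → Fin n → Carrier

  Σᶠ : (Fin n → Carrier) → Carrier
  Σᶠ f = foldr _+_ 0# (map f (allFin n))

  -- Directed walks (in a DAG every walk is a path).
  data Walk : Fin n → Fin n → Set where
    nil  : ∀ {i} → Walk i i
    step : ∀ {j k i} → Edge j k → Walk k i → Walk j i

  length : ∀ {j i} → Walk j i → ℕ
  length nil = nzero
  length (step _ p) = nsuc (length p)

  weight : Weights → ∀ {j i} → Walk j i → Carrier
  weight w nil = 0#
  weight w (step {j} {k} _ p) = w j k + weight w p

  oneEdge : ∀ {j i} → Edge j i → Walk j i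
  oneEdge e = step e nil

  Acyclic : Set
  Acyclic = ∀ i (p : Walk i i) → length p ≡ nzero

  IsShortest : Weights → ∀ {j i} → Walk j i → Set c
  IsShortest w {j} {i} p = ∀ (q : Walk j i) → weight w p ≤ weight w q

  UniqueShortest : Weights → ∀ {j i} → Walk j i → Set c
  UniqueShortest w {j} {i} p =
    IsShortest w p × (∀ (q : Walk j i) → IsShortest w q → q ≡ p)

  InFlat : Weights → Fin n → Fin n → Set c
  InFlat w j i = Σ (Edge j i) (λ e → UniqueShortest w (oneEdge e))

  FlatEqualsG : Weights → Set c
  FlatEqualsG w = ∀ j i → Edge j i ⇔ InFlat w j i

  -- The point configuration Δ_G = {0} ∪ {e_i - e_j : j → i ∈ E}.
  -- Labels: nothing = origin, just (j , i) = the point e_i - e_j.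
  Pt : Set
  Pt = Maybe (Fin n × Fin n)

  Valid : Pt → Set
  Valid nothing = Data.Unit.⊤ where import Data.Unit
  Valid (just (j , i)) = Edge j i

  δ : Fin n → Fin n → Carrier
  δ k l with k ≟ᶠ l
  ... | yes _ = 1#
  ... | no  _ = 0#

  coord : Pt → Fin n → Carrier
  coord nothing k = 0#
  coord (just (j , i)) k = δ k i - δ k j

  height : Weights → Pt → Carrier
  height w nothing = 0#
  height w (just (j , i)) = w j i

  -- sum over all labels (invalid labels are excluded by the callers
  -- through support conditions)
  Σᵖ : (Pt → Carrier) → Carrier
  Σᵖ f = f nothing + Σᶠ (λ j → Σᶠ (λ i → f (just (j , i))))

  dot : (Fin n → Carrier) → Pt → Carrier
  dot a p = Σᶠ (λ k → a k * coord p k)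

  -- Subsets of the configuration (finite, so Boolean-valued).
  Subset : Set
  Subset = Pt → Bool

  _∈_ : Pt → Subset → Set
  p ∈ S = S p ≡ true

  _⊆_ : Subset → Subset → Set
  S ⊆ T = ∀ p → p ∈ S → p ∈ T

  -- S is a cell of the regular subdivision induced by the heights:
  -- S is the set of points of the configuration lying on a lower face
  -- of the lifted configuration, i.e. there is a non-vertical affine
  -- function x ↦ a·x + c₀ lying weakly below all lifted points and
  -- touching exactly the points of S.
  IsCell : Weights → Subset → Set c
  IsCell w S =
    (∀ p → p ∈ S → Valid p) ×
    Σ (Fin n → Carrier) (λ a → Σ Carrier (λ c₀ →
      (∀ p → Valid p → c₀ ≤ height w p - dot a p) ×
      (∀ p → Valid p → (p ∈ S ⇔ (height w p - dot a p ≡ c₀)))))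

  IsMaximalCell : Weights → Subset → Set c
  IsMaximalCell w S = IsCell w S × (∀ T → IsCell w T → S ⊆ T → T ⊆ S)

  IsVertex : Subset → Pt → Set c
  IsVertex S p =
    p ∈ S ×
    (¬ Σ (Pt → Carrier) (λ λ' →
        (∀ q → λ' q ≢ 0# → (q ∈ S) × (q ≢ p)) ×
        (∀ q → 0# ≤ λ' q) ×
        (Σᵖ λ' ≡ 1#) ×
        (∀ k → Σᵖ (λ q → λ' q * coord q k) ≡ coord p k)))

  AffinelyIndependent : Subset → Set c
  AffinelyIndependent S =
    ∀ (λ' : Pt → Carrier) →
      (∀ q → λ' q ≢ 0# → q ∈ S) →
      Σᵖ λ' ≡ 0# →
      (∀ k → Σᵖ (λ q → λ' q * coord q k) ≡ 0#) →
      ∀ q → λ' q ≡ 0#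

  IsTriangulation : Weights → Set c
  IsTriangulation w = ∀ S → IsCell w S → AffinelyIndependent S

  IsCentral : Weights → Set c
  IsCentral w = ∀ S → IsMaximalCell w S → IsVertex S nothing

  IsCentralTriangulation : Weights → Set c
  IsCentralTriangulation w = IsCentral w × IsTriangulation w

-- Suppose an edge j → i had a shortcut: a walk r from j to i of length at least 2 with
-- weight r ≤ w(j→i). Large multiples of e_i − e_j cut out a cell containing e_i − e_j, and it
-- extends to a maximal cell T; both steps are classical, which costs nothing since the goal is ⊥.
-- By centrality the origin lies in T, so the lower supporting functional a of T has face value 0:
-- the reduced weights w(x→z) − (a_z − a_x) are nonnegative and vanish exactly on the edges in T.
-- They telescope along r to weight r − (a_i − a_j) ≤ 0, so every edge of r lies in T. Then
-- e_i − e_j = Σ_{x→z ∈ r} (e_z − e_x) is an affine dependence among the points of T whose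
-- coefficient at the origin is length r − 1 ≠ 0, contradicting that T is a simplex.

module Submission where

open import Defs
open import Level using (Level)
open import Algebra.Bundles using (CommutativeRing)
open import Axiom.UniquenessOfIdentityProofs using (module Decidable⇒UIP)
open import Data.Bool as Bool using (Bool; true; false; if_then_else_)
open import Data.Empty using (⊥-elim)
open import Data.Fin using (Fin; punchIn) renaming (zero to fzero; suc to fsuc)
open import Data.Fin.Properties using (punchInᵢ≢i) renaming (_≟_ to _≟ᶠ_)
open import Data.List using (List; []; _∷_; foldr; map; tabulate; allFin; cartesianProduct)
open import Data.List.Properties using (map-tabulate; map-cong)
open import Data.List.Membership.Propositional using () renaming (_∈_ to _∈ˡ_)
open import Data.List.Membership.Propositional.Properties using (∈-allFin; ∈-map⁺; ∈-cartesianProduct⁺)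
open import Data.List.Relation.Unary.Any using (here; there)
import Data.Maybe.Properties as Maybe
open import Data.Maybe using (just; nothing)
open import Data.Nat as ℕ using (ℕ; zero; suc; s≤s; z≤n)
open import Data.Nat.Induction using (<-wellFounded)
open import Data.Nat.Properties using (m≤n⇒m≤1+n)
open import Data.Product using (Σ; _×_; _,_; proj₁; proj₂)
import Data.Product.Properties as Product
open import Data.Sum using (inj₁; inj₂)
open import Data.Unit using (tt)
open import Function using (_∘_; id)
open import Function.Bundles using (Equivalence; mk⇔)
open import Induction.WellFounded using (Acc; acc)
open import Relation.Binary.Bundles using (Poset)
open import Relation.Binary.Definitions using (DecidableEquality)
open import Relation.Binary.Structures using (IsTotalOrder)
open import Relation.Binary.PropositionalEquality
  using (_≡_; _≢_; refl; sym; trans; cong; cong₂; subst; subst₂; module ≡-Reasoning)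
import Relation.Binary.Reasoning.PartialOrder as PartialOrderReasoning
open import Relation.Nullary using (¬_; Dec; yes; no; does)
open import Relation.Nullary.Decidable using (dec-true; dec-false; ¬¬-excluded-middle)

module OrderedFieldProperties {c : Level} (F : OrderedField c) where
  open OrderedField F

  commutativeRing : CommutativeRing c c
  commutativeRing = record { isCommutativeRing = isCommutativeRing }

  open CommutativeRing commutativeRing public
    using ( +-assoc; +-comm; +-identityˡ; +-identityʳ; -‿inverseˡ; -‿inverseʳ
          ; *-identityˡ; *-identityʳ; zeroˡ; zeroʳ; distribʳ; ring; semiring; +-abelianGroup)
  open import Algebra.Properties.Ring ring public
    using (-1*x≈-x; x[y-z]≈xy-xz; [y-z]x≈yx-zx; -‿distribˡ-*; -‿distribʳ-*)
  open import Algebra.Properties.AbelianGroup +-abelianGroup public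
    using (⁻¹-involutive; ε⁻¹≈ε; ⁻¹-∙-comm; \\-leftDividesˡ; \\-leftDividesʳ; //-rightDividesˡ)
  open import Algebra.Properties.CommutativeSemigroup
    (CommutativeRing.+-commutativeSemigroup commutativeRing) public
    using () renaming (interchange to +-interchange)
  open IsTotalOrder ≤-isTotalOrder public
    using (isPartialOrder; total; antisym)
    renaming (refl to ≤-refl; trans to ≤-trans; reflexive to ≤-reflexive)

  ≤-poset : Poset c c c
  ≤-poset = record { isPartialOrder = isPartialOrder }

  module ≤-Reasoning = PartialOrderReasoning ≤-poset

  x-0≡x : ∀ x → x - 0# ≡ x
  x-0≡x x = trans (cong (x +_) ε⁻¹≈ε) (+-identityʳ x)

  -x≡0⇒x≡0 : ∀ {x} → - x ≡ 0# → x ≡ 0#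
  -x≡0⇒x≡0 {x} -x≡0 = trans (sym (⁻¹-involutive x)) (trans (cong -_ -x≡0) ε⁻¹≈ε)

  x-[x+y]≡-y : ∀ x y → x - (x + y) ≡ - y
  x-[x+y]≡-y x y = trans (cong (x +_) (sym (⁻¹-∙-comm x y))) (\\-leftDividesˡ x (- y))

  -‿telescope : ∀ x y z → (y - x) + (z - y) ≡ z - x
  -‿telescope x y z = begin
    (y - x) + (z - y)    ≡⟨ +-comm (y - x) (z - y) ⟩
    (z - y) + (y - x)    ≡⟨ +-assoc z (- y) (y - x) ⟩
    z + (- y + (y - x))  ≡⟨ cong (z +_) (\\-leftDividesʳ y (- x)) ⟩
    z - x                ∎
    where open ≡-Reasoning

  -‿interchange : ∀ x y u v → (x - y) + (u - v) ≡ (x + u) - (y + v)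
  -‿interchange x y u v =
    trans (+-interchange x (- y) u (- v)) (cong ((x + u) +_) (⁻¹-∙-comm y v))

  -‿cancelʳ : ∀ x y z → (x + z) - (y + z) ≡ x - y
  -‿cancelʳ x y z = begin
    (x + z) - (y + z)  ≡⟨ -‿interchange x y z z ⟨
    (x - y) + (z - z)  ≡⟨ cong ((x - y) +_) (-‿inverseʳ z) ⟩
    (x - y) + 0#       ≡⟨ +-identityʳ (x - y) ⟩
    x - y              ∎
    where open ≡-Reasoning

  +-monoʳ-≤ : ∀ {x y} z → x ≤ y → z + x ≤ z + y
  +-monoʳ-≤ {x} {y} z x≤y = subst₂ _≤_ (+-comm x z) (+-comm y z) (+-monoˡ-≤ z x≤y)

  +-mono-≤ : ∀ {x y u v} → x ≤ y → u ≤ v → x + u ≤ y + v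
  +-mono-≤ {y = y} {u = u} x≤y u≤v = ≤-trans (+-monoˡ-≤ u x≤y) (+-monoʳ-≤ y u≤v)

  -‿antimono-≤ : ∀ {x y} → x ≤ y → - y ≤ - x
  -‿antimono-≤ {x} {y} x≤y =
    subst₂ _≤_ (\\-leftDividesˡ x (- y)) y+[-x-y]≡-x (+-monoˡ-≤ (- x + - y) x≤y)
    where
    y+[-x-y]≡-x : y + (- x + - y) ≡ - x
    y+[-x-y]≡-x = trans (cong (y +_) (+-comm (- x) (- y))) (\\-leftDividesˡ y (- x))

  -‿mono-≤ : ∀ {x x′ y y′} → x ≤ x′ → y′ ≤ y → x - y ≤ x′ - y′
  -‿mono-≤ x≤x′ y′≤y = +-mono-≤ x≤x′ (-‿antimono-≤ y′≤y)

  x+v≤u+y⇒x-y≤u-v : ∀ {x y u v} → x + v ≤ u + y → x - y ≤ u - v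
  x+v≤u+y⇒x-y≤u-v {x} {y} {u} {v} x+v≤u+y =
    subst₂ _≤_ (-‿cancelʳ x y v) [u+y]-[y+v]≡u-v (+-monoˡ-≤ (- (y + v)) x+v≤u+y)
    where
    [u+y]-[y+v]≡u-v : (u + y) - (y + v) ≡ u - v
    [u+y]-[y+v]≡u-v = trans (cong (λ t → (u + y) - t) (+-comm y v)) (-‿cancelʳ u v y)

  x-y≤z⇒x≤y+z : ∀ {x y z} → x - y ≤ z → x ≤ y + z
  x-y≤z⇒x≤y+z {x} {y} x-y≤z =
    subst (_≤ _) (trans (+-comm y (x - y)) (//-rightDividesˡ y x)) (+-monoʳ-≤ y x-y≤z)

  0≤x⇒-x≤0 : ∀ {x} → 0# ≤ x → - x ≤ 0#
  0≤x⇒-x≤0 0≤x = subst (_ ≤_) ε⁻¹≈ε (-‿antimono-≤ 0≤x)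

  x≤0⇒0≤-x : ∀ {x} → x ≤ 0# → 0# ≤ - x
  x≤0⇒0≤-x {x} x≤0 = subst₂ _≤_ (-‿inverseʳ x) (+-identityˡ (- x)) (+-monoˡ-≤ (- x) x≤0)

  0≤-x⇒x≤0 : ∀ {x} → 0# ≤ - x → x ≤ 0#
  0≤-x⇒x≤0 {x} 0≤-x = subst₂ _≤_ (+-identityˡ x) (-‿inverseˡ x) (+-monoˡ-≤ x 0≤-x)

  x+y≤0⇒x≡0∧y≤0 : ∀ {x y} → 0# ≤ x → 0# ≤ y → x + y ≤ 0# → x ≡ 0# × y ≤ 0#
  x+y≤0⇒x≡0∧y≤0 {x} {y} 0≤x 0≤y x+y≤0 =
    antisym (≤-trans (subst (_≤ x + y) (+-identityʳ x) (+-monoʳ-≤ x 0≤y)) x+y≤0) 0≤x ,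
    ≤-trans (subst (_≤ x + y) (+-identityˡ y) (+-monoˡ-≤ y 0≤x)) x+y≤0

  0≤x*x : ∀ x → 0# ≤ x * x
  0≤x*x x with total 0# x
  ... | inj₁ 0≤x = *-nonneg 0≤x 0≤x
  ... | inj₂ x≤0 = subst (0# ≤_) -x*-x≡x*x (*-nonneg (x≤0⇒0≤-x x≤0) (x≤0⇒0≤-x x≤0))
    where
    -x*-x≡x*x : - x * - x ≡ x * x
    -x*-x≡x*x = begin
      - x * - x      ≡⟨ -‿distribˡ-* x (- x) ⟨
      - (x * - x)    ≡⟨ cong -_ (-‿distribʳ-* x x) ⟨
      - - (x * x)    ≡⟨ ⁻¹-involutive (x * x) ⟩
      x * x          ∎
      where open ≡-Reasoning

  0≤1 : 0# ≤ 1#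
  0≤1 = subst (0# ≤_) (*-identityʳ 1#) (0≤x*x 1#)

  0≰-1 : ¬ (0# ≤ - 1#)
  0≰-1 0≤-1 = 0≢1 (antisym 0≤1 (0≤-x⇒x≤0 0≤-1))

  _⊔_ : Carrier → Carrier → Carrier
  x ⊔ y with total x y
  ... | inj₁ _ = y
  ... | inj₂ _ = x

  x≤x⊔y : ∀ x y → x ≤ x ⊔ y
  x≤x⊔y x y with total x y
  ... | inj₁ x≤y = x≤y
  ... | inj₂ _   = ≤-refl

  y≤x⊔y : ∀ x y → y ≤ x ⊔ y
  y≤x⊔y x y with total x y
  ... | inj₁ _   = ≤-refl
  ... | inj₂ y≤x = y≤x

  nonneg-upper-bound : ∀ {a} {A : Set a} (f : A → Carrier) (xs : List A) →
                       Σ Carrier λ b → 0# ≤ b × (∀ {x} → x ∈ˡ xs → f x ≤ b)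
  nonneg-upper-bound f [] = 0# , ≤-refl , λ ()
  nonneg-upper-bound f (x ∷ xs) with nonneg-upper-bound f xs
  ... | b , 0≤b , f≤b = f x ⊔ b , ≤-trans 0≤b (y≤x⊔y (f x) b) , bound
    where
    bound : ∀ {y} → y ∈ˡ x ∷ xs → f y ≤ f x ⊔ b
    bound (here refl)  = x≤x⊔y (f x) b
    bound (there y∈xs) = ≤-trans (f≤b y∈xs) (y≤x⊔y (f x) b)

module FiniteType {a : Level} {A : Set a} (elements : List A) (complete : ∀ x → x ∈ˡ elements) where

  ¬¬-decidable : ∀ {p} (P : A → Set p) → ¬ ¬ (∀ x → Dec (P x))
  ¬¬-decidable P ¬dec = ¬¬-decidable-on elements λ dec → ¬dec λ x → dec (complete x)
    where
    ¬¬-decidable-on : ∀ xs → ¬ ¬ (∀ {x} → x ∈ˡ xs → Dec (P x))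
    ¬¬-decidable-on [] ¬dec = ¬dec λ ()
    ¬¬-decidable-on (x ∷ xs) ¬dec = ¬¬-excluded-middle λ Px? → ¬¬-decidable-on xs λ dec →
      ¬dec λ { (here refl) → Px? ; (there y∈xs) → dec y∈xs }

  _⊆_ : (A → Bool) → (A → Bool) → Set a
  S ⊆ T = ∀ x → S x ≡ true → T x ≡ true

  missing : (A → Bool) → List A → ℕ
  missing S [] = 0
  missing S (x ∷ xs) = if S x then missing S xs else suc (missing S xs)

  missing-mono : ∀ {S T} → S ⊆ T → ∀ xs → missing T xs ℕ.≤ missing S xs
  missing-mono S⊆T [] = z≤n
  missing-mono {S} {T} S⊆T (x ∷ xs) with S x in Sx | T x in Tx
  ... | true  | true  = missing-mono S⊆T xs
  ... | true  | false with () ← trans (sym (S⊆T x Sx)) Tx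
  ... | false | true  = m≤n⇒m≤1+n (missing-mono S⊆T xs)
  ... | false | false = s≤s (missing-mono S⊆T xs)

  missing-strict : ∀ {S T} → S ⊆ T → ∀ {y} xs → y ∈ˡ xs → T y ≡ true → S y ≡ false →
                   missing T xs ℕ.< missing S xs
  missing-strict {S} {T} S⊆T (x ∷ xs) (here refl) Ty Sy rewrite Ty | Sy = s≤s (missing-mono S⊆T xs)
  missing-strict {S} {T} S⊆T (x ∷ xs) (there y∈xs) Ty Sy with S x in Sx | T x in Tx
  ... | true  | true  = missing-strict S⊆T xs y∈xs Ty Sy
  ... | true  | false with () ← trans (sym (S⊆T x Sx)) Tx
  ... | false | true  = m≤n⇒m≤1+n (missing-strict S⊆T xs y∈xs Ty Sy)
  ... | false | false = s≤s (missing-strict S⊆T xs y∈xs Ty Sy)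

  module _ {p} (P : (A → Bool) → Set p) where

    IsMaximal : (A → Bool) → Set (a Level.⊔ p)
    IsMaximal S = P S × (∀ T → P T → S ⊆ T → T ⊆ S)

    ¬¬-maximal-above : ∀ {S} → P S → ¬ ¬ Σ (A → Bool) λ T → IsMaximal T × S ⊆ T
    ¬¬-maximal-above {S} = go S (<-wellFounded (missing S elements))
      where
      go : ∀ S → Acc ℕ._<_ (missing S elements) → P S → ¬ ¬ Σ (A → Bool) λ T → IsMaximal T × S ⊆ T
      go S (acc smaller) PS ¬max = ¬max (S , (PS , maximal) , λ _ Sx → Sx)
        where
        maximal : ∀ U → P U → S ⊆ U → U ⊆ S
        maximal U PU S⊆U x Ux with S x in Sx
        ... | true = refl
        ... | false = ⊥-elim (go U (smaller (missing-strict S⊆U elements (complete x) Ux Sx)) PU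
          λ (T , T-max , U⊆T) → ¬max (T , T-max , λ y Sy → U⊆T y (S⊆U y Sy)))

module GeometryProperties {c : Level} (F : OrderedField c) (n : ℕ) (E : Fin n → Fin n → Bool) where
  open OrderedField F
  open OrderedFieldProperties F
  open Geometry F n E
  open import Algebra.Properties.Semiring.Sum semiring
    using (sum; sum-cong-≗; ∑-distrib-+; sum-remove; sum-replicate-zero; *-distribˡ-sum)

  -- Finite sums

  sum-neg : ∀ {m} (f : Fin m → Carrier) → sum (λ k → - f k) ≡ - sum f
  sum-neg f = begin
    sum (λ k → - f k)         ≡⟨ sum-cong-≗ (λ k → -1*x≈-x (f k)) ⟨
    sum (λ k → - 1# * f k)    ≡⟨ *-distribˡ-sum (- 1#) f ⟨
    - 1# * sum f              ≡⟨ -1*x≈-x (sum f) ⟩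
    - sum f                   ∎
    where open ≡-Reasoning

  sum-zero : ∀ {m} {f : Fin m → Carrier} → (∀ k → f k ≡ 0#) → sum f ≡ 0#
  sum-zero {m} f≡0 = trans (sum-cong-≗ f≡0) (sum-replicate-zero m)

  sum-point : ∀ {m} {f : Fin m → Carrier} i → (∀ k → k ≢ i → f k ≡ 0#) → sum f ≡ f i
  sum-point {suc m} {f} i f≡0 = begin
    sum f                          ≡⟨ sum-remove {i = i} f ⟩
    f i + sum (f ∘ punchIn i)      ≡⟨ cong (f i +_) (sum-zero (λ k → f≡0 _ (punchInᵢ≢i i k))) ⟩
    f i + 0#                       ≡⟨ +-identityʳ (f i) ⟩
    f i                            ∎
    where open ≡-Reasoning

  Σᶠ≡sum : ∀ f → Σᶠ f ≡ sum f
  Σᶠ≡sum f = trans (cong (foldr _+_ 0#) (map-tabulate id f)) (foldr-tabulate f)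
    where
    foldr-tabulate : ∀ {m} (g : Fin m → Carrier) → foldr _+_ 0# (tabulate g) ≡ sum g
    foldr-tabulate {zero} g = refl
    foldr-tabulate {suc m} g = cong (g fzero +_) (foldr-tabulate (g ∘ fsuc))

  Σᶠ-cong : ∀ {f g} → (∀ k → f k ≡ g k) → Σᶠ f ≡ Σᶠ g
  Σᶠ-cong f≗g = cong (foldr _+_ 0#) (map-cong f≗g (allFin n))

  Σᶠ-+ : ∀ f g → Σᶠ (λ k → f k + g k) ≡ Σᶠ f + Σᶠ g
  Σᶠ-+ f g = trans (Σᶠ≡sum _) (trans (∑-distrib-+ f g) (sym (cong₂ _+_ (Σᶠ≡sum f) (Σᶠ≡sum g))))

  Σᶠ-neg : ∀ f → Σᶠ (λ k → - f k) ≡ - Σᶠ f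
  Σᶠ-neg f = trans (Σᶠ≡sum _) (trans (sum-neg f) (cong -_ (sym (Σᶠ≡sum f))))

  Σᶠ-zero : ∀ {f} → (∀ k → f k ≡ 0#) → Σᶠ f ≡ 0#
  Σᶠ-zero {f} f≡0 = trans (Σᶠ≡sum f) (sum-zero f≡0)

  Σᶠ-point : ∀ {f} i → (∀ k → k ≢ i → f k ≡ 0#) → Σᶠ f ≡ f i
  Σᶠ-point {f} i f≡0 = trans (Σᶠ≡sum f) (sum-point i f≡0)

  Σᵖ-cong : ∀ {f g} → (∀ p → f p ≡ g p) → Σᵖ f ≡ Σᵖ g
  Σᵖ-cong f≗g = cong₂ _+_ (f≗g nothing) (Σᶠ-cong λ j → Σᶠ-cong λ i → f≗g (just (j , i)))

  Σᵖ-+ : ∀ f g → Σᵖ (λ p → f p + g p) ≡ Σᵖ f + Σᵖ g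
  Σᵖ-+ f g = trans (cong (f nothing + g nothing +_) (trans (Σᶠ-cong λ j → Σᶠ-+ _ _) (Σᶠ-+ _ _)))
                   (+-interchange _ _ _ _)

  Σᵖ-neg : ∀ f → Σᵖ (λ p → - f p) ≡ - Σᵖ f
  Σᵖ-neg f = trans (cong (- f nothing +_) (trans (Σᶠ-cong λ j → Σᶠ-neg _) (Σᶠ-neg _)))
                   (⁻¹-∙-comm _ _)

  Σᵖ-zero : ∀ {f} → (∀ p → f p ≡ 0#) → Σᵖ f ≡ 0#
  Σᵖ-zero f≡0 = trans (cong₂ _+_ (f≡0 nothing) (Σᶠ-zero λ j → Σᶠ-zero λ i → f≡0 (just (j , i))))
                      (+-identityʳ 0#)

  Σᵖ-point : ∀ {f} p → (∀ q → q ≢ p → f q ≡ 0#) → Σᵖ f ≡ f p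
  Σᵖ-point nothing f≡0 =
    trans (cong (_ +_) (Σᶠ-zero λ j → Σᶠ-zero λ i → f≡0 (just (j , i)) λ ())) (+-identityʳ _)
  Σᵖ-point {f} (just (j , i)) f≡0 = begin
    f nothing + Σᶠ (λ k → Σᶠ (λ l → f (just (k , l))))
      ≡⟨ cong₂ _+_ (f≡0 nothing λ ()) (Σᶠ-point j row≡0) ⟩
    0# + Σᶠ (λ l → f (just (j , l)))
      ≡⟨ +-identityˡ _ ⟩
    Σᶠ (λ l → f (just (j , l)))
      ≡⟨ Σᶠ-point i column≡0 ⟩
    f (just (j , i)) ∎
    where
    open ≡-Reasoning
    row≡0 : ∀ k → k ≢ j → Σᶠ (λ l → f (just (k , l))) ≡ 0#
    row≡0 k k≢j = Σᶠ-zero λ l → f≡0 (just (k , l)) (k≢j ∘ cong proj₁ ∘ Maybe.just-injective)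
    column≡0 : ∀ l → l ≢ i → f (just (j , l)) ≡ 0#
    column≡0 l l≢i = f≡0 (just (j , l)) (l≢i ∘ cong proj₂ ∘ Maybe.just-injective)

  δ-refl : ∀ k → δ k k ≡ 1#
  δ-refl k with k ≟ᶠ k
  ... | yes _ = refl
  ... | no k≢k = ⊥-elim (k≢k refl)

  δ-≢ : ∀ {k l} → k ≢ l → δ k l ≡ 0#
  δ-≢ {k} {l} k≢l with k ≟ᶠ l
  ... | yes k≡l = ⊥-elim (k≢l k≡l)
  ... | no _ = refl

  dot-origin : ∀ a → dot a nothing ≡ 0#
  dot-origin a = Σᶠ-zero λ k → zeroʳ (a k)

  dot-edge : ∀ a u v → dot a (just (u , v)) ≡ a v - a u
  dot-edge a u v = begin
    Σᶠ (λ k → a k * (δ k v - δ k u))          ≡⟨ Σᶠ-cong (λ k → x[y-z]≈xy-xz (a k) (δ k v) (δ k u)) ⟩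
    Σᶠ (λ k → a k * δ k v - a k * δ k u)      ≡⟨ Σᶠ-+ _ _ ⟩
    Σᶠ (λ k → a k * δ k v) + Σᶠ (λ k → - (a k * δ k u))
                                              ≡⟨ cong₂ _+_ (pick v) (trans (Σᶠ-neg _) (cong -_ (pick u))) ⟩
    a v - a u                                 ∎
    where
    open ≡-Reasoning
    pick : ∀ l → Σᶠ (λ k → a k * δ k l) ≡ a l
    pick l = trans (Σᶠ-point l λ k k≢l → trans (cong (a k *_) (δ-≢ k≢l)) (zeroʳ (a k)))
                   (trans (cong (a l *_) (δ-refl l)) (*-identityʳ (a l)))

  _≟ᵖ_ : DecidableEquality Pt
  _≟ᵖ_ = Maybe.≡-dec (Product.≡-dec _≟ᶠ_ _≟ᶠ_)

  δᵖ : Pt → Pt → Carrier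
  δᵖ p q = if does (p ≟ᵖ q) then 1# else 0#

  δᵖ-refl : ∀ p → δᵖ p p ≡ 1#
  δᵖ-refl p rewrite dec-true (p ≟ᵖ p) refl = refl

  δᵖ-≢ : ∀ {p q} → p ≢ q → δᵖ p q ≡ 0#
  δᵖ-≢ {p} {q} p≢q rewrite dec-false (p ≟ᵖ q) p≢q = refl

  -- Walks

  weight-cong : ∀ {f g} → (∀ x z → f x z ≡ g x z) → ∀ {j i} (r : Walk j i) → weight f r ≡ weight g r
  weight-cong f≗g nil = refl
  weight-cong f≗g (step {x} {z} _ r) = cong₂ _+_ (f≗g x z) (weight-cong f≗g r)

  weight-sub : ∀ f g {j i} (r : Walk j i) →
               weight (λ x z → f x z - g x z) r ≡ weight f r - weight g r
  weight-sub f g nil = sym (x-0≡x 0#)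
  weight-sub f g (step {x} {z} _ r) =
    trans (cong (f x z - g x z +_) (weight-sub f g r)) (-‿interchange _ _ _ _)

  weight-telescopes : ∀ (φ : Fin n → Carrier) {j i} (r : Walk j i) →
                      weight (λ x z → φ z - φ x) r ≡ φ i - φ j
  weight-telescopes φ {j} nil = sym (-‿inverseʳ (φ j))
  weight-telescopes φ (step {x} {z} {i} _ r) =
    trans (cong (φ z - φ x +_) (weight-telescopes φ r)) (-‿telescope (φ x) (φ z) (φ i))

  weight-dot : ∀ a {j i} (r : Walk j i) → weight (λ x z → dot a (just (x , z))) r ≡ dot a (just (j , i))
  weight-dot a {j} {i} r = begin
    weight (λ x z → dot a (just (x , z))) r  ≡⟨ weight-cong (dot-edge a) r ⟩
    weight (λ x z → a z - a x) r             ≡⟨ weight-telescopes a r ⟩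
    a i - a j                                ≡⟨ dot-edge a j i ⟨
    dot a (just (j , i))                     ∎
    where open ≡-Reasoning

  weight-nonneg : ∀ {f} → (∀ {x z} → Edge x z → 0# ≤ f x z) → ∀ {j i} (r : Walk j i) → 0# ≤ weight f r
  weight-nonneg f≥0 nil = ≤-refl
  weight-nonneg {f} f≥0 (step {x} {z} e r) =
    subst (_≤ f x z + weight f r) (+-identityʳ 0#) (+-mono-≤ (f≥0 e) (weight-nonneg f≥0 r))

  weight-nonpos : ∀ {f} → (∀ {x z} → Edge x z → f x z ≤ 0#) → ∀ {j i} (r : Walk j i) → weight f r ≤ 0#
  weight-nonpos f≤0 nil = ≤-refl
  weight-nonpos {f} f≤0 (step {x} {z} e r) =
    subst (f x z + weight f r ≤_) (+-identityʳ 0#) (+-mono-≤ (f≤0 e) (weight-nonpos f≤0 r))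

  -- The affine relation of a shortcut

  ⟪_,_⟫ : (Pt → Carrier) → (Pt → Carrier) → Carrier
  ⟪ α , g ⟫ = Σᵖ (λ q → α q * g q)

  ⟪δᵖ⟫ : ∀ p g → ⟪ δᵖ p , g ⟫ ≡ g p
  ⟪δᵖ⟫ p g = trans (Σᵖ-point p λ q q≢p → trans (cong (_* g q) (δᵖ-≢ (q≢p ∘ sym))) (zeroˡ (g q)))
                   (trans (cong (_* g p) (δᵖ-refl p)) (*-identityˡ (g p)))

  ⟪⟫-+ : ∀ α β g → ⟪ (λ q → α q + β q) , g ⟫ ≡ ⟪ α , g ⟫ + ⟪ β , g ⟫
  ⟪⟫-+ α β g =
    trans (Σᵖ-cong λ q → distribʳ (g q) (α q) (β q)) (Σᵖ-+ (λ q → α q * g q) (λ q → β q * g q))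

  ⟪⟫-sub : ∀ α β g → ⟪ (λ q → α q - β q) , g ⟫ ≡ ⟪ α , g ⟫ - ⟪ β , g ⟫
  ⟪⟫-sub α β g = begin
    Σᵖ (λ q → (α q - β q) * g q)            ≡⟨ Σᵖ-cong (λ q → [y-z]x≈yx-zx (g q) (α q) (β q)) ⟩
    Σᵖ (λ q → α q * g q - β q * g q)        ≡⟨ Σᵖ-+ (λ q → α q * g q) (λ q → - (β q * g q)) ⟩
    ⟪ α , g ⟫ + Σᵖ (λ q → - (β q * g q))    ≡⟨ cong (⟪ α , g ⟫ +_) (Σᵖ-neg (λ q → β q * g q)) ⟩
    ⟪ α , g ⟫ - ⟪ β , g ⟫                   ∎
    where open ≡-Reasoning

  ⟪0⟫ : ∀ g → ⟪ (λ _ → 0#) , g ⟫ ≡ 0#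
  ⟪0⟫ g = Σᵖ-zero λ q → zeroˡ (g q)

  -- For a walk r from j to i, dependence r encodes the
  -- affine relation (e_i − e_j) − 0 = Σ_{x→z ∈ r} ((e_z − e_x) − 0); its coefficient at the
  -- origin is length r − 1.

  edgeVector : Fin n → Fin n → Pt → Carrier
  edgeVector x z q = δᵖ (just (x , z)) q - δᵖ nothing q

  walkVector : ∀ {j i} → Walk j i → Pt → Carrier
  walkVector r q = weight (λ x z → edgeVector x z q) r

  dependence : ∀ {j i} → Walk j i → Pt → Carrier
  dependence {j} {i} r q = edgeVector j i q - walkVector r q

  ⟪edgeVector⟫ : ∀ x z g → ⟪ edgeVector x z , g ⟫ ≡ g (just (x , z)) - g nothing
  ⟪edgeVector⟫ x z g =
    trans (⟪⟫-sub (δᵖ (just (x , z))) (δᵖ nothing) g) (cong₂ _-_ (⟪δᵖ⟫ _ g) (⟪δᵖ⟫ nothing g))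

  ⟪walkVector⟫ : ∀ g {j i} (r : Walk j i) →
                 ⟪ walkVector r , g ⟫ ≡ weight (λ x z → g (just (x , z)) - g nothing) r
  ⟪walkVector⟫ g nil = ⟪0⟫ g
  ⟪walkVector⟫ g (step {x} {z} _ r) =
    trans (⟪⟫-+ (edgeVector x z) (walkVector r) g)
          (cong₂ _+_ (⟪edgeVector⟫ x z g) (⟪walkVector⟫ g r))

  ⟪dependence⟫≡0 : ∀ g (φ : Fin n → Carrier) → (∀ x z → g (just (x , z)) - g nothing ≡ φ z - φ x) →
                   ∀ {j i} (r : Walk j i) → ⟪ dependence r , g ⟫ ≡ 0#
  ⟪dependence⟫≡0 g φ g≡dφ {j} {i} r = begin
    ⟪ dependence r , g ⟫
      ≡⟨ ⟪⟫-sub (edgeVector j i) (walkVector r) g ⟩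
    ⟪ edgeVector j i , g ⟫ - ⟪ walkVector r , g ⟫
      ≡⟨ cong₂ _-_ (⟪edgeVector⟫ j i g) (⟪walkVector⟫ g r) ⟩
    (g (just (j , i)) - g nothing) - weight (λ x z → g (just (x , z)) - g nothing) r
      ≡⟨ cong₂ _-_ (g≡dφ j i) (weight-cong g≡dφ r) ⟩
    (φ i - φ j) - weight (λ x z → φ z - φ x) r
      ≡⟨ cong (λ t → (φ i - φ j) - t) (weight-telescopes φ r) ⟩
    (φ i - φ j) - (φ i - φ j)
      ≡⟨ -‿inverseʳ (φ i - φ j) ⟩
    0# ∎
    where open ≡-Reasoning

  dependence-mass : ∀ {j i} (r : Walk j i) → Σᵖ (dependence r) ≡ 0#
  dependence-mass r = trans (Σᵖ-cong λ q → sym (*-identityʳ (dependence r q)))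
    (⟪dependence⟫≡0 (λ _ → 1#) (λ _ → 0#) (λ _ _ → trans (-‿inverseʳ 1#) (sym (-‿inverseʳ 0#))) r)

  dependence-moment : ∀ {j i} (r : Walk j i) k → Σᵖ (λ q → dependence r q * coord q k) ≡ 0#
  dependence-moment r k = ⟪dependence⟫≡0 (λ q → coord q k) (δ k) (λ x z → x-0≡x _) r

  dependence-origin≢0 : ∀ {j i} (r : Walk j i) → 2 ℕ.≤ length r → dependence r nothing ≢ 0#
  dependence-origin≢0 (step _ nil) (s≤s ())
  dependence-origin≢0 (step _ (step _ r)) _ eq = 0≰-1 (begin
    0#                     ≡⟨ u+R≡0 ⟨
    u + R                  ≤⟨ +-monoʳ-≤ u R≤0 ⟩
    u + 0#                 ≡⟨ +-identityʳ u ⟩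
    0# - 1#                ≡⟨ +-identityˡ (- 1#) ⟩
    - 1#                   ∎)
    where
    open ≤-Reasoning
    u : Carrier
    u = 0# - 1#
    R : Carrier
    R = weight (λ _ _ → u) r
    R≤0 : R ≤ 0#
    R≤0 = weight-nonpos (λ _ → subst (_≤ 0#) (sym (+-identityˡ (- 1#))) (0≤x⇒-x≤0 0≤1)) r
    u+R≡0 : u + R ≡ 0#
    u+R≡0 = -x≡0⇒x≡0 (trans (sym (x-[x+y]≡-y u (u + R))) eq)

  data EdgesIn (T : Subset) : ∀ {j i} → Walk j i → Set where
    nil : ∀ {i} → EdgesIn T (nil {i})
    _∷_ : ∀ {j k i} {e : Edge j k} {r : Walk k i} → just (j , k) ∈ T → EdgesIn T r → EdgesIn T (step e r)

  zero-edges-in : ∀ {T f} → (∀ {x z} → Edge x z → 0# ≤ f x z) →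
                  (∀ {x z} → Edge x z → f x z ≡ 0# → just (x , z) ∈ T) →
                  ∀ {j i} (r : Walk j i) → weight f r ≤ 0# → EdgesIn T r
  zero-edges-in f≥0 zero⇒∈T nil _ = nil
  zero-edges-in f≥0 zero⇒∈T (step e r) fr≤0
    with x+y≤0⇒x≡0∧y≤0 (f≥0 e) (weight-nonneg f≥0 r) fr≤0
  ... | fe≡0 , r≤0 = zero⇒∈T e fe≡0 ∷ zero-edges-in f≥0 zero⇒∈T r r≤0

  ∈∧∉⇒≢ : ∀ {T p q} → p ∈ T → T q ≡ false → p ≢ q
  ∈∧∉⇒≢ p∈T q∉T refl with () ← trans (sym p∈T) q∉T

  edgeVector-vanishes : ∀ {T x z} → nothing ∈ T → just (x , z) ∈ T →
                        ∀ q → T q ≡ false → edgeVector x z q ≡ 0#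
  edgeVector-vanishes {T} 0∈T xz∈T q q∉T =
    trans (cong₂ _-_ (δᵖ-≢ (∈∧∉⇒≢ {T} xz∈T q∉T)) (δᵖ-≢ (∈∧∉⇒≢ {T} 0∈T q∉T))) (x-0≡x 0#)

  walkVector-vanishes : ∀ {T j i} {r : Walk j i} → nothing ∈ T → EdgesIn T r →
                        ∀ q → T q ≡ false → walkVector r q ≡ 0#
  walkVector-vanishes 0∈T nil q q∉T = refl
  walkVector-vanishes {T} 0∈T (xz∈T ∷ r⊆T) q q∉T =
    trans (cong₂ _+_ (edgeVector-vanishes {T} 0∈T xz∈T q q∉T) (walkVector-vanishes {T} 0∈T r⊆T q q∉T))
          (+-identityʳ 0#)

  shortcut-affinely-dependent : ∀ {T j i} {r : Walk j i} → nothing ∈ T → just (j , i) ∈ T →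
                                EdgesIn T r → 2 ℕ.≤ length r → ¬ AffinelyIndependent T
  shortcut-affinely-dependent {T} {r = r} 0∈T ji∈T r⊆T 2≤|r| independent =
    dependence-origin≢0 r 2≤|r|
      (independent (dependence r) supported (dependence-mass r) (dependence-moment r) nothing)
    where
    vanishes : ∀ q → T q ≡ false → dependence r q ≡ 0#
    vanishes q q∉T = trans (cong₂ _-_ (edgeVector-vanishes {T} 0∈T ji∈T q q∉T)
                                      (walkVector-vanishes {T} 0∈T r⊆T q q∉T))
                           (x-0≡x 0#)
    supported : ∀ q → dependence r q ≢ 0# → q ∈ T
    supported q dep≢0 with T q in Tq
    ... | true = refl
    ... | false = ⊥-elim (dep≢0 (vanishes q Tq))

  -- Cells of the regular subdivision

  points : List Pt
  points = nothing ∷ map just (cartesianProduct (allFin n) (allFin n))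

  points-complete : ∀ p → p ∈ˡ points
  points-complete nothing = here refl
  points-complete (just (j , i)) = there (∈-map⁺ just (∈-cartesianProduct⁺ (∈-allFin j) (∈-allFin i)))

  open FiniteType points points-complete using (¬¬-decidable; ¬¬-maximal-above)

  module _ (w : Weights) where

    ¬¬-cell-containing-face : ∀ a c₀ → (∀ p → Valid p → c₀ ≤ height w p - dot a p) →
      ¬ ¬ Σ Subset λ S → IsCell w S × (∀ p → Valid p → height w p - dot a p ≡ c₀ → p ∈ S)
    ¬¬-cell-containing-face a c₀ below ¬cell = ¬¬-decidable OnFace λ on-face? →
      let open Face on-face? in ¬cell (face , face-cell , λ p valid → on-face⇒face p ∘ (valid ,_))
      where
      OnFace : Pt → Set c
      OnFace p = Valid p × height w p - dot a p ≡ c₀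

      module Face (on-face? : ∀ p → Dec (OnFace p)) where
        face : Subset
        face p = does (on-face? p)

        face⇒on-face : ∀ p → p ∈ face → OnFace p
        face⇒on-face p with on-face? p
        ... | yes on-face = λ _ → on-face
        ... | no _        = λ ()

        on-face⇒face : ∀ p → OnFace p → p ∈ face
        on-face⇒face p = dec-true (on-face? p)

        face-cell : IsCell w face
        face-cell = (λ p → proj₁ ∘ face⇒on-face p) , a , c₀ , below
                  , λ p valid → mk⇔ (proj₂ ∘ face⇒on-face p) (on-face⇒face p ∘ (valid ,_))

    -- The functional pot = M (e_i − e_j) is 2M at e_i − e_j and at most M at every other point, so
    -- once M dominates every w(j→i) − height p it touches the lifted configuration only there.
    module EdgeFace {j i : Fin n} (j≢i : j ≢ i) where

      bound : Σ Carrier λ b → 0# ≤ b × (∀ {p} → p ∈ˡ points → w j i - height w p ≤ b)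
      bound = nonneg-upper-bound (λ p → w j i - height w p) points

      M : Carrier
      M = proj₁ bound

      0≤M : 0# ≤ M
      0≤M = proj₁ (proj₂ bound)

      w≤height+M : ∀ p → w j i ≤ height w p + M
      w≤height+M p = x-y≤z⇒x≤y+z (proj₂ (proj₂ bound) (points-complete p))

      -M≤0 : - M ≤ 0#
      -M≤0 = 0≤x⇒-x≤0 0≤M

      pot : Fin n → Carrier
      pot k with k ≟ᶠ i | k ≟ᶠ j
      ... | yes _ | _     = M
      ... | no _  | yes _ = - M
      ... | no _  | no _  = 0#

      pot-i : pot i ≡ M
      pot-i with i ≟ᶠ i
      ... | yes _ = refl
      ... | no i≢i = ⊥-elim (i≢i refl)

      pot-j : pot j ≡ - M
      pot-j with j ≟ᶠ i | j ≟ᶠ j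
      ... | yes j≡i | _     = ⊥-elim (j≢i j≡i)
      ... | no _    | yes _ = refl
      ... | no _    | no j≢j = ⊥-elim (j≢j refl)

      0≤pot : ∀ {k} → k ≢ j → 0# ≤ pot k
      0≤pot {k} k≢j with k ≟ᶠ i | k ≟ᶠ j
      ... | yes _ | _       = 0≤M
      ... | no _  | yes k≡j = ⊥-elim (k≢j k≡j)
      ... | no _  | no _    = ≤-refl

      pot≤0 : ∀ {k} → k ≢ i → pot k ≤ 0#
      pot≤0 {k} k≢i with k ≟ᶠ i | k ≟ᶠ j
      ... | yes k≡i | _     = ⊥-elim (k≢i k≡i)
      ... | no _    | yes _ = -M≤0
      ... | no _    | no _  = ≤-refl

      -M≤pot : ∀ k → - M ≤ pot k
      -M≤pot k with k ≟ᶠ i | k ≟ᶠ j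
      ... | yes _ | _     = ≤-trans -M≤0 0≤M
      ... | no _  | yes _ = ≤-refl
      ... | no _  | no _  = -M≤0

      dot-pot-edge : dot pot (just (j , i)) ≡ M + M
      dot-pot-edge = begin
        dot pot (just (j , i))  ≡⟨ dot-edge pot j i ⟩
        pot i - pot j           ≡⟨ cong₂ _-_ pot-i pot-j ⟩
        M - - M                 ≡⟨ cong (M +_) (⁻¹-involutive M) ⟩
        M + M                   ∎
        where open ≡-Reasoning

      dot-pot≤M : ∀ p → p ≢ just (j , i) → dot pot p ≤ M
      dot-pot≤M nothing _ = subst (_≤ M) (sym (dot-origin pot)) 0≤M
      dot-pot≤M (just (u , v)) uv≢ji = subst (_≤ M) (sym (dot-edge pot u v)) (pot-difference (v ≟ᶠ i))
        where
        pot-difference : Dec (v ≡ i) → pot v - pot u ≤ M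
        pot-difference (yes refl) = subst (pot v - pot u ≤_) (x-0≡x M)
          (-‿mono-≤ (≤-reflexive pot-i) (0≤pot {u} λ { refl → uv≢ji refl }))
        pot-difference (no v≢i) = subst (pot v - pot u ≤_) (trans (+-identityˡ (- - M)) (⁻¹-involutive M))
          (-‿mono-≤ (pot≤0 v≢i) (-M≤pot u))

      c₀ : Carrier
      c₀ = height w (just (j , i)) - dot pot (just (j , i))

      c₀≤ : ∀ p → c₀ ≤ height w p - dot pot p
      c₀≤ p with p ≟ᵖ just (j , i)
      ... | yes refl = ≤-refl
      ... | no p≢ji = x+v≤u+y⇒x-y≤u-v (begin
        w j i + dot pot p                    ≤⟨ +-mono-≤ (w≤height+M p) (dot-pot≤M p p≢ji) ⟩
        (height w p + M) + M                 ≡⟨ +-assoc (height w p) M M ⟩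
        height w p + (M + M)                 ≡⟨ cong (height w p +_) dot-pot-edge ⟨
        height w p + dot pot (just (j , i))  ∎)
        where open ≤-Reasoning

    ¬¬-cell-containing-edge : ∀ {j i} → Edge j i → j ≢ i →
                              ¬ ¬ Σ Subset λ S → IsCell w S × just (j , i) ∈ S
    ¬¬-cell-containing-edge e j≢i ¬cell = ¬¬-cell-containing-face pot c₀ (λ p _ → c₀≤ p)
      λ (S , S-cell , face⊆S) → ¬cell (S , S-cell , face⊆S _ e refl)
      where open EdgeFace j≢i

    shortcut-in-cell : ∀ {T j i} → IsCell w T → nothing ∈ T → just (j , i) ∈ T →
                       (r : Walk j i) → weight w r ≤ w j i → EdgesIn T r
    shortcut-in-cell {T} {j} {i} (valid , a , c₀ , below , on-face⇔) 0∈T ji∈T r r≤w =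
      zero-edges-in {T} {slack} (λ e → subst (_≤ _) c₀≡0 (below _ e))
        (λ e slack≡0 → Equivalence.from (on-face⇔ _ e) (trans slack≡0 (sym c₀≡0))) r slack-r≤0
      where
      slack : Weights
      slack x z = height w (just (x , z)) - dot a (just (x , z))
      c₀≡0 : c₀ ≡ 0#
      c₀≡0 = trans (sym (Equivalence.to (on-face⇔ nothing tt) 0∈T))
                   (trans (cong (λ t → 0# - t) (dot-origin a)) (x-0≡x 0#))
      slack-r≤0 : weight slack r ≤ 0#
      slack-r≤0 = begin
        weight slack r
          ≡⟨ weight-sub w _ r ⟩
        weight w r - weight (λ x z → dot a (just (x , z))) r
          ≡⟨ cong (λ t → weight w r - t) (weight-dot a r) ⟩
        weight w r - dot a (just (j , i))
          ≤⟨ +-monoˡ-≤ _ r≤w ⟩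
        w j i - dot a (just (j , i))
          ≡⟨ Equivalence.to (on-face⇔ _ (valid _ ji∈T)) ji∈T ⟩
        c₀
          ≡⟨ c₀≡0 ⟩
        0# ∎
        where open ≤-Reasoning

    no-shortcut : IsCentralTriangulation w → ∀ {j i} → Edge j i → j ≢ i →
                  (r : Walk j i) → 2 ℕ.≤ length r → ¬ (weight w r ≤ w j i)
    no-shortcut (central , triangulation) e j≢i r 2≤|r| r≤w =
      ¬¬-cell-containing-edge e j≢i λ (S , S-cell , ji∈S) →
      ¬¬-maximal-above (IsCell w) S-cell λ (T , T-maximal , S⊆T) →
      let T-cell = proj₁ T-maximal
          0∈T = proj₁ (central T T-maximal)
          ji∈T = S⊆T _ ji∈S
      in shortcut-affinely-dependent {T} 0∈T ji∈T (shortcut-in-cell T-cell 0∈T ji∈T r r≤w) 2≤|r|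
           (triangulation T T-cell)

  acyclic⇒irreflexive : Acyclic → ∀ {j i} → Edge j i → j ≢ i
  acyclic⇒irreflexive acyclic e refl with () ← acyclic _ (oneEdge e)

  module _ (w : Weights) (acyclic : Acyclic) (central-triangulation : IsCentralTriangulation w) where

    light-walk≡oneEdge : ∀ {j i} (e : Edge j i) (r : Walk j i) →
                         weight w r ≤ weight w (oneEdge e) → r ≡ oneEdge e
    light-walk≡oneEdge e nil _ = ⊥-elim (acyclic⇒irreflexive acyclic e refl)
    light-walk≡oneEdge e (step e′ nil) _ =
      cong (λ e″ → step e″ nil) (Decidable⇒UIP.≡-irrelevant Bool._≟_ e′ e)
    light-walk≡oneEdge {j} {i} e r@(step _ (step _ _)) r≤e = ⊥-elim
      (no-shortcut w central-triangulation e (acyclic⇒irreflexive acyclic e) r (s≤s (s≤s z≤n))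
        (subst (weight w r ≤_) (+-identityʳ (w j i)) r≤e))

    oneEdge-uniquely-shortest : ∀ {j i} (e : Edge j i) → UniqueShortest w (oneEdge e)
    oneEdge-uniquely-shortest e =
      shortest , λ r r-shortest → light-walk≡oneEdge e r (r-shortest (oneEdge e))
      where
      shortest : IsShortest w (oneEdge e)
      shortest r with total (weight w (oneEdge e)) (weight w r)
      ... | inj₁ e≤r = e≤r
      ... | inj₂ r≤e rewrite light-walk≡oneEdge e r r≤e = ≤-refl

corollary4p12 : {c : Level} (F : OrderedField c) (n : ℕ) (E : Fin n → Fin n → Bool)
    (w : Geometry.Weights F n E) →
    Geometry.Acyclic F n E →
    Geometry.IsCentralTriangulation F n E w →
    Geometry.FlatEqualsG F n E w
corollary4p12 F n E w acyclic central-triangulation j i =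
  mk⇔ (λ e → e , oneEdge-uniquely-shortest F n E w acyclic central-triangulation e) proj₁
  where open GeometryProperties
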